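{- System $\mathcal S_w$ enjoys subject reduction: if $\Gamma\vdash_{\mathcal S_w} t:\sigma$ and $t\to_\beta t'$, then $\Gamma\vdash_{\mathcal S_w} t':\sigma$.
   Context: $\lambda$-terms $t::=x\mid\lambda x.t\mid tu$; $\to_\beta$ is the contextual closure of $(\lambda x.t)u\to t\{u/x\}$ (capture-avoiding substitution). Types: $\sigma,\tau,\rho::=\alpha\mid A\to\tau$, $\alpha$ base types, multiset types $A=[\sigma_i]_{i\in I}$ finite possibly empty multisets ($[\,]$ empty). Environments $\Gamma$ map variables to multiset types, all but finitely many to $[\,]$; $\mathrm{dom}(\Gamma)=\{y:\Gamma(y)\ne[\,]\}$; $(\Gamma+\Delta)(y)=\Gamma(y)\uplus\Delta(y)$; $\Gamma\setminus y$ sets $y$ to $[\,]$; $\Gamma,x{:}A$ extends $\Gamma$ by mapping $x\notin\mathrm{dom}(\Gamma)$ to $A$. System $\mathcal S_w$: (var$_w$) $\Gamma,x{:}[\rho_1,\dots,\rho_n]\vdash x:\rho_i$ for $1\le i\le n$; ($\to$I) from $\Gamma\vdash t:\tau$ infer $\Gamma\setminus x\vdash\lambda x.t:\Gamma(x)\to\tau$; ($\to$E$_{\ne[]}$) from $\Gamma\vdash t:A\to\tau$, $\Delta\vdash u:A$, $A\ne[\,]$, infer $\Gamma+\Delta\vdash tu:\tau$; ($\to$E$_{[]}$) from $\Gamma\vdash t:[\,]\to\tau$ and $\Delta\vdash u:[\sigma]$ infer $\Gamma+\Delta\vdash tu:\tau$; (m) from $(\Delta_i\vdash t:\sigma_i)_{i\in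 I}$ ($I$ finite, possibly empty) infer $+_{i\in I}\Delta_i\vdash t:[\sigma_i]_{i\in I}$. -}

module Defs where

-- Multisets are represented by lists; multiset equality is the inductive
-- "permutation up to type equivalence" relation _≈ᵐ_ (nested, since
-- types contain multisets).

open import Data.Nat using (ℕ; zero; suc)
open import Data.List using (List; []; _∷_; _++_; [_])
open import Data.List.Membership.Propositional using (_∈_)
open import Relation.Binary.PropositionalEquality using (_≡_)
open import Relation.Nullary using (¬_)

data Term : Set where
  var : ℕ → Term
  lam : Term → Term
  app : Term → Term → Term

ext : (ℕ → ℕ) → ℕ → ℕ
ext ρ zero    = zero
ext ρ (suc n) = suc (ρ n)

rename : (ℕ → ℕ) → Term → Term
rename ρ (var n)   = var (ρ n)
rename ρ (lam t)   = lam (rename (ext ρ) t)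
rename ρ (app t u) = app (rename ρ t) (rename ρ u)

exts : (ℕ → Term) → ℕ → Term
exts σ zero    = var zero
exts σ (suc n) = rename suc (σ n)

subst : (ℕ → Term) → Term → Term
subst σ (var n)   = σ n
subst σ (lam t)   = lam (subst (exts σ) t)
subst σ (app t u) = app (subst σ t) (subst σ u)

subst-zero : Term → ℕ → Term
subst-zero u zero    = u
subst-zero u (suc n) = var n

subst0 : Term → Term → Term
subst0 t u = subst (subst-zero u) t

infix 4 _→β_
data _→β_ : Term → Term → Set where
  β    : ∀ {t u} → app (lam t) u →β subst0 t u
  ξlam : ∀ {t t'} → t →β t' → lam t →β lam t'
  ξl   : ∀ {t t' u} → t →β t' → app t u →β app t' u
  ξr   : ∀ {t u u'} → u →β u' → app t u →β app t u'

data Ty : Set where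
  base  : ℕ → Ty
  _⇒_   : List Ty → Ty → Ty

MTy : Set
MTy = List Ty

mutual
  infix 4 _≈_ _≈ᵐ_
  data _≈_ : Ty → Ty → Set where
    base : ∀ {α} → base α ≈ base α
    arr  : ∀ {A B σ τ} → A ≈ᵐ B → σ ≈ τ → (A ⇒ σ) ≈ (B ⇒ τ)

  data _≈ᵐ_ : MTy → MTy → Set where
    []  : [] ≈ᵐ []
    cons : ∀ {σ τ A B C} → σ ≈ τ → A ≈ᵐ (B ++ C) →
           (σ ∷ A) ≈ᵐ (B ++ τ ∷ C)

-- Environments: de Bruijn index n ↦ multiset type; positions beyond the
-- length of the list are mapped to [] (so dom is finite).

Env : Set
Env = List MTy

lookupE : Env → ℕ → MTy
lookupE []      n       = []
lookupE (A ∷ Γ) zero    = A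
lookupE (A ∷ Γ) (suc n) = lookupE Γ n

headE : Env → MTy
headE []      = []
headE (A ∷ Γ) = A

-- Γ \ 0, with the remaining indices shifted down (de Bruijn reading of
-- removing the bound variable)
tailE : Env → Env
tailE []      = []
tailE (A ∷ Γ) = Γ

_+E_ : Env → Env → Env
[]      +E Δ       = Δ
(A ∷ Γ) +E []      = A ∷ Γ
(A ∷ Γ) +E (B ∷ Δ) = (A ++ B) ∷ (Γ +E Δ)

_≈E_ : Env → Env → Set
Γ ≈E Δ = ∀ n → lookupE Γ n ≈ᵐ lookupE Δ n

mutual
  infix 3 _⊢_∶_ _⊢ᵐ_∶_
  data _⊢_∶_ : Env → Term → Ty → Set where
    var : ∀ {Γ n ρ} → ρ ∈ lookupE Γ n → Γ ⊢ var n ∶ ρ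
    lam : ∀ {Γ t τ} → Γ ⊢ t ∶ τ → tailE Γ ⊢ lam t ∶ (headE Γ ⇒ τ)
    -- (→E_{≠[]}); the two occurrences of A are equal as multisets
    app : ∀ {Γ Δ t u A A' τ} → Γ ⊢ t ∶ (A ⇒ τ) → Δ ⊢ᵐ u ∶ A' →
          A ≈ᵐ A' → ¬ (A ≡ []) → (Γ +E Δ) ⊢ app t u ∶ τ
    app[] : ∀ {Γ Δ t u σ τ} → Γ ⊢ t ∶ ([] ⇒ τ) → Δ ⊢ᵐ u ∶ [ σ ] →
            (Γ +E Δ) ⊢ app t u ∶ τ

  data _⊢ᵐ_∶_ : Env → Term → MTy → Set where
    []  : ∀ {t} → [] ⊢ᵐ t ∶ []
    _∷_ : ∀ {Δ Δs t σ A} → Δ ⊢ t ∶ σ → Δs ⊢ᵐ t ∶ A →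
          (Δ +E Δs) ⊢ᵐ t ∶ (σ ∷ A)

-- The heart of the matter is the substitution lemma: if Γ ⊢ t : τ with
-- Γ(x) = A, and Δ ⊢ u : A by rule (m), that is by one derivation of u per
-- element of A, then Γ∖x + Δ ⊢ t{u/x} : τ. It is proved by induction on the
-- derivation of t, distributing the derivations of u over the occurrences of x
-- in the same way as the rules (→E) and (m) split the environment of t.
-- Because multisets and environments are lists, every result only holds up to
-- multiset equivalence of types and environments; sums of environments form a
-- commutative semigroup for that equivalence.

module Submission where

open import Defs
open import Algebra.Bundles using (CommutativeSemigroup)
open import Algebra.Structures using (IsCommutativeSemigroup)
open import Data.List using (List; []; _∷_; _++_; [_])
open import Data.List.Properties using (++-assoc; ++-identityʳ; ∷-injectiveˡ; ∷-injectiveʳ)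
open import Data.List.Membership.Propositional using (_∈_)
open import Data.List.Membership.Propositional.Properties using (∈-++⁺ˡ; ∈-++⁺ʳ; ∈-++⁻)
open import Data.List.Relation.Binary.Pointwise as Pointwise using (Pointwise; []; _∷_; ++⁺)
open import Data.List.Relation.Unary.Any using (here; there)
open import Data.Nat using (ℕ; zero; suc)
open import Data.Product using (Σ; _×_; _,_)
open import Data.Sum using (inj₁; inj₂)
open import Level using (0ℓ)
open import Relation.Binary.Bundles using (Setoid)
open import Relation.Binary.Structures using (IsEquivalence)
open import Relation.Binary.PropositionalEquality as ≡ using (_≡_; refl; cong; cong₂)
open import Relation.Nullary using (¬_)
import Algebra.Properties.CommutativeSemigroup as CommutativeSemigroupProperties
import Relation.Binary.Reasoning.Setoid as SetoidReasoning

mutual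
  ≈-refl : ∀ {σ} → σ ≈ σ
  ≈-refl {base α} = base
  ≈-refl {A ⇒ σ}  = arr ≈ᵐ-refl ≈-refl

  ≈ᵐ-refl : ∀ {A} → A ≈ᵐ A
  ≈ᵐ-refl {[]}    = []
  ≈ᵐ-refl {σ ∷ A} = cons {B = []} ≈-refl ≈ᵐ-refl

≈ᵐ-reflexive : ∀ {A B} → A ≡ B → A ≈ᵐ B
≈ᵐ-reflexive refl = ≈ᵐ-refl

insert-remove-commute : ∀ {X : Set} (B C E₁ E₂ : List X) (e τ : X) →
  B ++ C ≡ E₁ ++ e ∷ E₂ →
  Σ (List X) λ G₁ → Σ (List X) λ G₂ → Σ (List X) λ H₁ → Σ (List X) λ H₂ →
  (B ++ τ ∷ C ≡ G₁ ++ e ∷ G₂) × (G₁ ++ G₂ ≡ H₁ ++ τ ∷ H₂) × (H₁ ++ H₂ ≡ E₁ ++ E₂)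
insert-remove-commute []      C E₁       E₂ e τ refl = τ ∷ E₁ , E₂ , [] , E₁ ++ E₂ , refl , refl , refl
insert-remove-commute (b ∷ B) C []       E₂ e τ refl = [] , B ++ τ ∷ C , B , C , refl , refl , refl
insert-remove-commute (b ∷ B) C (x ∷ E₁) E₂ e τ eq
  with insert-remove-commute B C E₁ E₂ e τ (∷-injectiveʳ eq) | ∷-injectiveˡ eq
... | G₁ , G₂ , H₁ , H₂ , p₁ , p₂ , p₃ | refl =
  b ∷ G₁ , G₂ , b ∷ H₁ , H₂ , cong (b ∷_) p₁ , cong (b ∷_) p₂ , cong (b ∷_) p₃

≈ᵐ-insert : ∀ X₁ {X₂ B C ξ τ} → (X₁ ++ X₂) ≈ᵐ (B ++ C) → ξ ≈ τ →
  (X₁ ++ ξ ∷ X₂) ≈ᵐ (B ++ τ ∷ C)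
≈ᵐ-insert X₁ p s = go X₁ p refl s
  where
  go : ∀ X₁ {X₂ Y B C ξ τ} → (X₁ ++ X₂) ≈ᵐ Y → Y ≡ B ++ C → ξ ≈ τ →
       (X₁ ++ ξ ∷ X₂) ≈ᵐ (B ++ τ ∷ C)
  go []       p refl s = cons s p
  go (x ∷ X₁) {X₂} {B = B} {C} {ξ} {τ} (cons {τ = e} {B = E₁} {C = E₂} s' p) eq s
    with insert-remove-commute B C E₁ E₂ e τ (≡.sym eq)
  ... | G₁ , G₂ , H₁ , H₂ , p₁ , p₂ , p₃ rewrite p₁ =
    cons s' (≡.subst ((X₁ ++ ξ ∷ X₂) ≈ᵐ_) (≡.sym p₂) (go X₁ p (≡.sym p₃) s))

mutual
  ≈-sym : ∀ {σ τ} → σ ≈ τ → τ ≈ σ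
  ≈-sym base      = base
  ≈-sym (arr p s) = arr (≈ᵐ-sym p) (≈-sym s)

  ≈ᵐ-sym : ∀ {A B} → A ≈ᵐ B → B ≈ᵐ A
  ≈ᵐ-sym []                 = []
  ≈ᵐ-sym (cons {B = B} s p) = ≈ᵐ-insert B {B = []} (≈ᵐ-sym p) (≈-sym s)

≈ᵐ-uncons : ∀ {X σ A} → X ≈ᵐ (σ ∷ A) →
  Σ MTy λ X₁ → Σ MTy λ X₂ → Σ Ty λ ξ →
  (X ≡ X₁ ++ ξ ∷ X₂) × (ξ ≈ σ) × ((X₁ ++ X₂) ≈ᵐ A)
≈ᵐ-uncons p = go p refl
  where
  go : ∀ {X Y σ A} → X ≈ᵐ Y → Y ≡ σ ∷ A →
       Σ MTy λ X₁ → Σ MTy λ X₂ → Σ Ty λ ξ →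
       (X ≡ X₁ ++ ξ ∷ X₂) × (ξ ≈ σ) × ((X₁ ++ X₂) ≈ᵐ A)
  go (cons {σ = x} {B = []} s p) refl = [] , _ , x , refl , s , p
  go (cons {σ = x} {B = _ ∷ _} s p) refl with go p refl
  ... | X₁ , X₂ , ξ , refl , s' , p' = x ∷ X₁ , X₂ , ξ , refl , s' , cons s p'

mutual
  ≈-trans : ∀ {σ τ ρ} → σ ≈ τ → τ ≈ ρ → σ ≈ ρ
  ≈-trans base      base      = base
  ≈-trans (arr p s) (arr q t) = arr (≈ᵐ-trans p q) (≈-trans s t)

  ≈ᵐ-trans : ∀ {X Y Z} → X ≈ᵐ Y → Y ≈ᵐ Z → X ≈ᵐ Z
  ≈ᵐ-trans p [] = p
  ≈ᵐ-trans p (cons {B = B} {C = C} s q) with ≈ᵐ-uncons p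
  ... | X₁ , _ , _ , refl , s' , p' = ≈ᵐ-insert X₁ {B = B} {C = C} (≈ᵐ-trans p' q) (≈-trans s' s)

≈ᵐ-setoid : Setoid 0ℓ 0ℓ
≈ᵐ-setoid = record
  { Carrier       = MTy
  ; _≈_           = _≈ᵐ_
  ; isEquivalence = record { refl = ≈ᵐ-refl ; sym = ≈ᵐ-sym ; trans = ≈ᵐ-trans }
  }

++-congᵐ : ∀ {A A' B B'} → A ≈ᵐ A' → B ≈ᵐ B' → (A ++ B) ≈ᵐ (A' ++ B')
++-congᵐ [] q = q
++-congᵐ {B' = B'} (cons {τ = τ} {B = E₁} {C = E₂} s p) q =
  ≡.subst (_ ≈ᵐ_) (≡.sym (++-assoc E₁ (τ ∷ E₂) B'))
    (cons {B = E₁} {C = E₂ ++ B'} s (≡.subst (_ ≈ᵐ_) (++-assoc E₁ E₂ B') (++-congᵐ p q)))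

++-commᵐ : ∀ A B → (A ++ B) ≈ᵐ (B ++ A)
++-commᵐ []      B = ≈ᵐ-reflexive (≡.sym (++-identityʳ B))
++-commᵐ (σ ∷ A) B = cons {B = B} {C = A} ≈-refl (++-commᵐ A B)

≈ᵐ-nonempty : ∀ {A B} → A ≈ᵐ B → ¬ A ≡ [] → ¬ B ≡ []
≈ᵐ-nonempty p A≢[] refl = A≢[] (≈ᵐ-[]ˡ (≈ᵐ-sym p))
  where
  ≈ᵐ-[]ˡ : ∀ {B} → [] ≈ᵐ B → B ≡ []
  ≈ᵐ-[]ˡ [] = refl

∈-≈ᵐ : ∀ {ρ A B} → ρ ∈ A → A ≈ᵐ B → Σ Ty λ ρ' → (ρ' ∈ B) × (ρ ≈ ρ')
∈-≈ᵐ (here refl) (cons {τ = τ} {B = B} s _) = τ , ∈-++⁺ʳ B (here refl) , s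
∈-≈ᵐ (there i)   (cons {B = B} _ p) with ∈-≈ᵐ i p
... | ρ' , i' , s with ∈-++⁻ B i'
...   | inj₁ i₁ = ρ' , ∈-++⁺ˡ i₁ , s
...   | inj₂ i₂ = ρ' , ∈-++⁺ʳ B (there i₂) , s

infix 4 _≈ᵖ_
_≈ᵖ_ : MTy → MTy → Set
_≈ᵖ_ = Pointwise _≈_

≈ᵖ⇒≈ᵐ : ∀ {A B} → A ≈ᵖ B → A ≈ᵐ B
≈ᵖ⇒≈ᵐ []      = []
≈ᵖ⇒≈ᵐ (s ∷ p) = cons {B = []} s (≈ᵖ⇒≈ᵐ p)

≈ᵖ-++⁻ : ∀ X {Y B} → (X ++ Y) ≈ᵖ B →
  Σ MTy λ X' → Σ MTy λ Y' → (B ≡ X' ++ Y') × (X ≈ᵖ X') × (Y ≈ᵖ Y')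
≈ᵖ-++⁻ []      p       = [] , _ , refl , [] , p
≈ᵖ-++⁻ (_ ∷ X) (s ∷ p) with ≈ᵖ-++⁻ X p
... | X' , Y' , refl , p₁ , p₂ = _ ∷ X' , Y' , refl , s ∷ p₁ , p₂

-- A record rather than the function type Γ ≈E Δ, so that Γ and Δ can be inferred.
infix 4 _∼E_
record _∼E_ (Γ Δ : Env) : Set where
  constructor mk∼E
  field ∼E⇒≈E : Γ ≈E Δ
open _∼E_

≡⇒∼E : ∀ {Γ Δ} → Γ ≡ Δ → Γ ∼E Δ
≡⇒∼E refl = mk∼E λ _ → ≈ᵐ-refl

∼E-refl : ∀ {Γ} → Γ ∼E Γ
∼E-refl = ≡⇒∼E refl

∼E-sym : ∀ {Γ Δ} → Γ ∼E Δ → Δ ∼E Γ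
∼E-sym (mk∼E p) = mk∼E λ n → ≈ᵐ-sym (p n)

∼E-trans : ∀ {Γ Δ Θ} → Γ ∼E Δ → Δ ∼E Θ → Γ ∼E Θ
∼E-trans (mk∼E p) (mk∼E q) = mk∼E λ n → ≈ᵐ-trans (p n) (q n)

∼E-isEquivalence : IsEquivalence _∼E_
∼E-isEquivalence = record { refl = ∼E-refl ; sym = ∼E-sym ; trans = ∼E-trans }

∼E-setoid : Setoid 0ℓ 0ℓ
∼E-setoid = record { isEquivalence = ∼E-isEquivalence }

∷-congE : ∀ {A B Γ Δ} → A ≈ᵐ B → Γ ∼E Δ → (A ∷ Γ) ∼E (B ∷ Δ)
∷-congE p (mk∼E q) = mk∼E λ { zero → p ; (suc n) → q n }

lookup-+E : ∀ Γ Δ n → lookupE (Γ +E Δ) n ≡ lookupE Γ n ++ lookupE Δ n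
lookup-+E []      Δ       n       = refl
lookup-+E (A ∷ Γ) []      n       = ≡.sym (++-identityʳ _)
lookup-+E (A ∷ Γ) (B ∷ Δ) zero    = refl
lookup-+E (A ∷ Γ) (B ∷ Δ) (suc n) = lookup-+E Γ Δ n

+E-cong : ∀ {Γ Γ' Δ Δ'} → Γ ∼E Γ' → Δ ∼E Δ' → (Γ +E Δ) ∼E (Γ' +E Δ')
+E-cong {Γ} {Γ'} {Δ} {Δ'} (mk∼E p) (mk∼E q) = mk∼E λ n → begin
  lookupE (Γ +E Δ) n             ≡⟨ lookup-+E Γ Δ n ⟩
  lookupE Γ n ++ lookupE Δ n     ≈⟨ ++-congᵐ (p n) (q n) ⟩
  lookupE Γ' n ++ lookupE Δ' n   ≡⟨ lookup-+E Γ' Δ' n ⟨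
  lookupE (Γ' +E Δ') n           ∎
  where open SetoidReasoning ≈ᵐ-setoid

+E-comm : ∀ Γ Δ → (Γ +E Δ) ∼E (Δ +E Γ)
+E-comm Γ Δ = mk∼E λ n → begin
  lookupE (Γ +E Δ) n           ≡⟨ lookup-+E Γ Δ n ⟩
  lookupE Γ n ++ lookupE Δ n   ≈⟨ ++-commᵐ (lookupE Γ n) (lookupE Δ n) ⟩
  lookupE Δ n ++ lookupE Γ n   ≡⟨ lookup-+E Δ Γ n ⟨
  lookupE (Δ +E Γ) n           ∎
  where open SetoidReasoning ≈ᵐ-setoid

+E-assoc : ∀ Γ Δ Θ → (Γ +E Δ) +E Θ ≡ Γ +E (Δ +E Θ)
+E-assoc []      Δ       Θ       = refl
+E-assoc (A ∷ Γ) []      Θ       = refl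
+E-assoc (A ∷ Γ) (B ∷ Δ) []      = refl
+E-assoc (A ∷ Γ) (B ∷ Δ) (C ∷ Θ) = cong₂ _∷_ (++-assoc A B C) (+E-assoc Γ Δ Θ)

+E-identityʳ : ∀ Γ → Γ +E [] ≡ Γ
+E-identityʳ []      = refl
+E-identityʳ (A ∷ Γ) = refl

+E-isCommutativeSemigroup : IsCommutativeSemigroup _∼E_ _+E_
+E-isCommutativeSemigroup = record
  { isSemigroup = record
    { isMagma = record { isEquivalence = ∼E-isEquivalence ; ∙-cong = +E-cong }
    ; assoc   = λ Γ Δ Θ → ≡⇒∼E (+E-assoc Γ Δ Θ)
    }
  ; comm = +E-comm
  }

+E-commutativeSemigroup : CommutativeSemigroup 0ℓ 0ℓ
+E-commutativeSemigroup = record { isCommutativeSemigroup = +E-isCommutativeSemigroup }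

open CommutativeSemigroupProperties +E-commutativeSemigroup using (interchange; x∙yz≈y∙xz)

headE-lookup : ∀ Γ → headE Γ ≡ lookupE Γ 0
headE-lookup []      = refl
headE-lookup (A ∷ Γ) = refl

tailE-lookup : ∀ Γ n → lookupE (tailE Γ) n ≡ lookupE Γ (suc n)
tailE-lookup []      n = refl
tailE-lookup (A ∷ Γ) n = refl

headE-+E : ∀ Γ Δ → headE (Γ +E Δ) ≡ headE Γ ++ headE Δ
headE-+E []      Δ       = refl
headE-+E (A ∷ Γ) []      = ≡.sym (++-identityʳ A)
headE-+E (A ∷ Γ) (B ∷ Δ) = refl

tailE-+E : ∀ Γ Δ → tailE (Γ +E Δ) ≡ tailE Γ +E tailE Δ
tailE-+E []      Δ       = refl
tailE-+E (A ∷ Γ) []      = ≡.sym (+E-identityʳ Γ)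
tailE-+E (A ∷ Γ) (B ∷ Δ) = refl

headE-cong : ∀ {Γ Δ} → Γ ∼E Δ → headE Γ ≈ᵐ headE Δ
headE-cong {Γ} {Δ} (mk∼E p) =
  ≡.subst₂ _≈ᵐ_ (≡.sym (headE-lookup Γ)) (≡.sym (headE-lookup Δ)) (p 0)

tailE-cong : ∀ {Γ Δ} → Γ ∼E Δ → tailE Γ ∼E tailE Δ
tailE-cong {Γ} {Δ} (mk∼E p) = mk∼E λ n →
  ≡.subst₂ _≈ᵐ_ (≡.sym (tailE-lookup Γ n)) (≡.sym (tailE-lookup Δ n)) (p (suc n))

⊢-weaken : ∀ W {Γ t σ} → Γ ⊢ t ∶ σ → (W +E Γ) ⊢ t ∶ σ
⊢-weaken W {Γ} (var {n = n} i) =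
  var (≡.subst (_ ∈_) (≡.sym (lookup-+E W Γ n)) (∈-++⁺ʳ (lookupE W n) i))
⊢-weaken W (lam {Γ = Γ} {τ = τ} d) =
  ≡.subst₂ (λ E A → E ⊢ _ ∶ (A ⇒ τ)) (tailE-[]∷ W Γ) (headE-[]∷ W Γ) (lam (⊢-weaken ([] ∷ W) d))
  where
  tailE-[]∷ : ∀ W Γ → tailE (([] ∷ W) +E Γ) ≡ W +E tailE Γ
  tailE-[]∷ W []      = ≡.sym (+E-identityʳ W)
  tailE-[]∷ W (A ∷ Γ) = refl

  headE-[]∷ : ∀ W Γ → headE (([] ∷ W) +E Γ) ≡ headE Γ
  headE-[]∷ W []      = refl
  headE-[]∷ W (A ∷ Γ) = refl
⊢-weaken W (app {Γ = Γ} {Δ = Δ} d m e A≢[]) =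
  ≡.subst (_⊢ _ ∶ _) (+E-assoc W Γ Δ) (app (⊢-weaken W d) m e A≢[])
⊢-weaken W (app[] {Γ = Γ} {Δ = Δ} d m) =
  ≡.subst (_⊢ _ ∶ _) (+E-assoc W Γ Δ) (app[] (⊢-weaken W d) m)

infix 3 _⊢≈_∶_ _⊢ᵐ≈_∶_
data _⊢≈_∶_ (Γ : Env) (t : Term) (σ : Ty) : Set where
  ≈-typed : ∀ {Γ' σ'} → Γ ∼E Γ' → σ ≈ σ' → Γ' ⊢ t ∶ σ' → Γ ⊢≈ t ∶ σ

-- Pointwise, so that the splitting of a multiset into a concatenation, and
-- the singleton required by (→E_[]), survive the equivalence.
data _⊢ᵐ≈_∶_ (Δ : Env) (u : Term) (A : MTy) : Set where
  ≈ᵐ-typed : ∀ {Δ' A'} → Δ ∼E Δ' → A ≈ᵖ A' → Δ' ⊢ᵐ u ∶ A' → Δ ⊢ᵐ≈ u ∶ A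

⊢⇒⊢≈ : ∀ {Γ t σ} → Γ ⊢ t ∶ σ → Γ ⊢≈ t ∶ σ
⊢⇒⊢≈ = ≈-typed ∼E-refl ≈-refl

⊢ᵐ⇒⊢ᵐ≈ : ∀ {Δ u A} → Δ ⊢ᵐ u ∶ A → Δ ⊢ᵐ≈ u ∶ A
⊢ᵐ⇒⊢ᵐ≈ = ≈ᵐ-typed ∼E-refl (Pointwise.refl ≈-refl)

⊢≈-resp : ∀ {Γ Γ' t σ σ'} → Γ ∼E Γ' → σ ≈ σ' → Γ' ⊢≈ t ∶ σ' → Γ ⊢≈ t ∶ σ
⊢≈-resp eΓ eσ (≈-typed eΓ' eσ' d) = ≈-typed (∼E-trans eΓ eΓ') (≈-trans eσ eσ') d

⊢ᵐ≈-resp : ∀ {Δ Δ' u A} → Δ ∼E Δ' → Δ' ⊢ᵐ≈ u ∶ A → Δ ⊢ᵐ≈ u ∶ A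
⊢ᵐ≈-resp eΔ (≈ᵐ-typed eΔ' eA m) = ≈ᵐ-typed (∼E-trans eΔ eΔ') eA m

⊢≈-lam : ∀ {Γ t τ} → Γ ⊢≈ t ∶ τ → tailE Γ ⊢≈ lam t ∶ (headE Γ ⇒ τ)
⊢≈-lam (≈-typed eΓ eτ d) = ≈-typed (tailE-cong eΓ) (arr (headE-cong eΓ) eτ) (lam d)

⊢≈-app : ∀ {Γ Δ t u A A' τ} → Γ ⊢≈ t ∶ (A ⇒ τ) → Δ ⊢ᵐ≈ u ∶ A' → A ≈ᵐ A' → ¬ A ≡ [] →
  (Γ +E Δ) ⊢≈ app t u ∶ τ
⊢≈-app (≈-typed eΓ (arr eA eτ) d) (≈ᵐ-typed eΔ eA' m) e A≢[] =
  ≈-typed (+E-cong eΓ eΔ) eτ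
    (app d m (≈ᵐ-trans (≈ᵐ-sym eA) (≈ᵐ-trans e (≈ᵖ⇒≈ᵐ eA'))) (≈ᵐ-nonempty eA A≢[]))

⊢≈-app[] : ∀ {Γ Δ t u σ τ} → Γ ⊢≈ t ∶ ([] ⇒ τ) → Δ ⊢ᵐ≈ u ∶ [ σ ] →
  (Γ +E Δ) ⊢≈ app t u ∶ τ
⊢≈-app[] (≈-typed eΓ (arr [] eτ) d) (≈ᵐ-typed eΔ (_ ∷ []) m) =
  ≈-typed (+E-cong eΓ eΔ) eτ (app[] d m)

⊢ᵐ≈-∷ : ∀ {Γ Δ t σ A} → Γ ⊢≈ t ∶ σ → Δ ⊢ᵐ≈ t ∶ A → (Γ +E Δ) ⊢ᵐ≈ t ∶ (σ ∷ A)
⊢ᵐ≈-∷ (≈-typed eΓ eσ d) (≈ᵐ-typed eΔ eA m) = ≈ᵐ-typed (+E-cong eΓ eΔ) (eσ ∷ eA) (d ∷ m)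

punchIn : ℕ → ℕ → ℕ
punchIn zero    = suc
punchIn (suc j) = ext (punchIn j)

punchInE : ℕ → Env → Env
punchInE zero    Γ = [] ∷ Γ
punchInE (suc j) Γ = headE Γ ∷ punchInE j (tailE Γ)

lookup-punchInE : ∀ j Γ n → lookupE (punchInE j Γ) (punchIn j n) ≡ lookupE Γ n
lookup-punchInE zero    Γ n       = refl
lookup-punchInE (suc j) Γ zero    = headE-lookup Γ
lookup-punchInE (suc j) Γ (suc n) = ≡.trans (lookup-punchInE j (tailE Γ) n) (tailE-lookup Γ n)

lookup-punchInE-[] : ∀ j n → lookupE (punchInE j []) n ≡ []
lookup-punchInE-[] zero    zero    = refl
lookup-punchInE-[] zero    (suc n) = refl
lookup-punchInE-[] (suc j) zero    = refl
lookup-punchInE-[] (suc j) (suc n) = lookup-punchInE-[] j n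

punchInE-+E : ∀ j Γ Δ → punchInE j (Γ +E Δ) ≡ punchInE j Γ +E punchInE j Δ
punchInE-+E zero    Γ Δ = refl
punchInE-+E (suc j) Γ Δ = cong₂ _∷_ (headE-+E Γ Δ)
  (≡.trans (cong (punchInE j) (tailE-+E Γ Δ)) (punchInE-+E j (tailE Γ) (tailE Δ)))

mutual
  ⊢-rename : ∀ j {Γ t σ} → Γ ⊢ t ∶ σ → punchInE j Γ ⊢≈ rename (punchIn j) t ∶ σ
  ⊢-rename j {Γ} (var {n = n} i) =
    ⊢⇒⊢≈ (var (≡.subst (_ ∈_) (≡.sym (lookup-punchInE j Γ n)) i))
  ⊢-rename j (lam d) = ⊢≈-lam (⊢-rename (suc j) d)
  ⊢-rename j (app {Γ = Γ} {Δ = Δ} d m e A≢[]) =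
    ⊢≈-resp (≡⇒∼E (punchInE-+E j Γ Δ)) ≈-refl (⊢≈-app (⊢-rename j d) (⊢ᵐ-rename j m) e A≢[])
  ⊢-rename j (app[] {Γ = Γ} {Δ = Δ} d m) =
    ⊢≈-resp (≡⇒∼E (punchInE-+E j Γ Δ)) ≈-refl (⊢≈-app[] (⊢-rename j d) (⊢ᵐ-rename j m))

  ⊢ᵐ-rename : ∀ j {Δ u A} → Δ ⊢ᵐ u ∶ A → punchInE j Δ ⊢ᵐ≈ rename (punchIn j) u ∶ A
  ⊢ᵐ-rename j [] = ≈ᵐ-typed (mk∼E λ n → ≈ᵐ-reflexive (lookup-punchInE-[] j n)) [] []
  ⊢ᵐ-rename j (_∷_ {Δ = Δ} {Δs = Δs} d m) =
    ⊢ᵐ≈-resp (≡⇒∼E (punchInE-+E j Δ Δs)) (⊢ᵐ≈-∷ (⊢-rename j d) (⊢ᵐ-rename j m))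

⊢ᵐ-++⁻ : ∀ X {Y Δ u} → Δ ⊢ᵐ u ∶ (X ++ Y) →
  Σ Env λ Δ₁ → Σ Env λ Δ₂ → (Δ ≡ Δ₁ +E Δ₂) × (Δ₁ ⊢ᵐ u ∶ X) × (Δ₂ ⊢ᵐ u ∶ Y)
⊢ᵐ-++⁻ []      m = [] , _ , refl , [] , m
⊢ᵐ-++⁻ (_ ∷ X) (_∷_ {Δ = Δ} d m) with ⊢ᵐ-++⁻ X m
... | Δ₁ , Δ₂ , refl , m₁ , m₂ = Δ +E Δ₁ , Δ₂ , ≡.sym (+E-assoc Δ Δ₁ Δ₂) , d ∷ m₁ , m₂

⊢ᵐ-++⁺ : ∀ {Δ₁ Δ₂ u X Y} → Δ₁ ⊢ᵐ u ∶ X → Δ₂ ⊢ᵐ u ∶ Y → (Δ₁ +E Δ₂) ⊢ᵐ u ∶ (X ++ Y)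
⊢ᵐ-++⁺                []                       m₂ = m₂
⊢ᵐ-++⁺ {Δ₂ = Δ₂} (_∷_ {Δ = Δ} {Δs = Δs} d m₁) m₂ =
  ≡.subst (_⊢ᵐ _ ∶ _) (≡.sym (+E-assoc Δ Δs Δ₂)) (d ∷ ⊢ᵐ-++⁺ m₁ m₂)

⊢ᵐ-∈ : ∀ {Δ u A ρ} → Δ ⊢ᵐ u ∶ A → ρ ∈ A →
  Σ Env λ Δ₁ → Σ Env λ Δ₂ → (Δ ∼E Δ₁ +E Δ₂) × (Δ₁ ⊢ u ∶ ρ)
⊢ᵐ-∈ (d ∷ _) (here refl) = _ , _ , ∼E-refl , d
⊢ᵐ-∈ (_∷_ {Δ = Δ} _ m) (there i) with ⊢ᵐ-∈ m i
... | Δ₁ , Δ₂ , eΔ , d = Δ₁ , Δ +E Δ₂ , ∼E-trans (+E-cong (∼E-refl {Δ}) eΔ) (x∙yz≈y∙xz Δ Δ₁ Δ₂) , d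

⊢ᵐ-≈ᵐ : ∀ {Δ u A B} → Δ ⊢ᵐ u ∶ A → A ≈ᵐ B → Δ ⊢ᵐ≈ u ∶ B
⊢ᵐ-≈ᵐ [] [] = ⊢ᵐ⇒⊢ᵐ≈ []
⊢ᵐ-≈ᵐ (_∷_ {Δ = Δ} d m) (cons {B = B₁} s p) with ⊢ᵐ-≈ᵐ m p
... | ≈ᵐ-typed eΔ eA m' with ≈ᵖ-++⁻ B₁ eA
...   | _ , _ , refl , e₁ , e₂ with ⊢ᵐ-++⁻ _ m'
...     | Δ₁ , Δ₂ , refl , m₁ , m₂ =
  ≈ᵐ-typed (∼E-trans (+E-cong (∼E-refl {Δ}) eΔ) (x∙yz≈y∙xz Δ Δ₁ Δ₂))
           (++⁺ e₁ (≈-sym s ∷ e₂)) (⊢ᵐ-++⁺ m₁ (d ∷ m₂))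

⊢ᵐ-split : ∀ X Y {Δ u A} → Δ ⊢ᵐ u ∶ A → (X ++ Y) ≈ᵐ A →
  Σ Env λ Δ₁ → Σ Env λ Δ₂ → Σ MTy λ A₁ → Σ MTy λ A₂ →
  (Δ ∼E Δ₁ +E Δ₂) × (X ≈ᵐ A₁) × (Y ≈ᵐ A₂) × (Δ₁ ⊢ᵐ u ∶ A₁) × (Δ₂ ⊢ᵐ u ∶ A₂)
⊢ᵐ-split X Y m e with ⊢ᵐ-≈ᵐ m (≈ᵐ-sym e)
... | ≈ᵐ-typed eΔ eXY m' with ≈ᵖ-++⁻ X eXY
...   | A₁ , A₂ , refl , e₁ , e₂ with ⊢ᵐ-++⁻ A₁ m'
...     | Δ₁ , Δ₂ , refl , m₁ , m₂ = Δ₁ , Δ₂ , A₁ , A₂ , eΔ , ≈ᵖ⇒≈ᵐ e₁ , ≈ᵖ⇒≈ᵐ e₂ , m₁ , m₂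

-- substAt k u replaces index k by u (under k binders) and shifts the indices above k down.
substAt : ℕ → Term → ℕ → Term
substAt zero    u = subst-zero u
substAt (suc k) u = exts (substAt k u)

punchOutE : ℕ → Env → Env
punchOutE zero    Γ = tailE Γ
punchOutE (suc k) Γ = headE Γ ∷ punchOutE k (tailE Γ)

padE : ℕ → Env → Env
padE zero    Δ = Δ
padE (suc k) Δ = [] ∷ padE k Δ

substEnv : ℕ → Env → Env → Env
substEnv k Γ Δ = punchOutE k Γ +E padE k Δ

punchOutE-+E : ∀ k Γ Δ → punchOutE k (Γ +E Δ) ≡ punchOutE k Γ +E punchOutE k Δ
punchOutE-+E zero    Γ Δ = tailE-+E Γ Δ
punchOutE-+E (suc k) Γ Δ = cong₂ _∷_ (headE-+E Γ Δ)
  (≡.trans (cong (punchOutE k) (tailE-+E Γ Δ)) (punchOutE-+E k (tailE Γ) (tailE Δ)))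

padE-+E : ∀ k Δ₁ Δ₂ → padE k (Δ₁ +E Δ₂) ≡ padE k Δ₁ +E padE k Δ₂
padE-+E zero    Δ₁ Δ₂ = refl
padE-+E (suc k) Δ₁ Δ₂ = cong ([] ∷_) (padE-+E k Δ₁ Δ₂)

padE-cong : ∀ k {Δ Δ'} → Δ ∼E Δ' → padE k Δ ∼E padE k Δ'
padE-cong zero    eΔ = eΔ
padE-cong (suc k) eΔ = ∷-congE ≈ᵐ-refl (padE-cong k eΔ)

substEnv-[] : ∀ k → substEnv k [] [] ∼E []
substEnv-[] k = mk∼E λ n → ≈ᵐ-reflexive (begin
  lookupE (substEnv k [] []) n
    ≡⟨ lookup-+E (punchOutE k []) (padE k []) n ⟩
  lookupE (punchOutE k []) n ++ lookupE (padE k []) n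
    ≡⟨ cong₂ _++_ (punchOut-[] k n) (pad-[] k n) ⟩
  [] ∎)
  where
  open ≡.≡-Reasoning

  punchOut-[] : ∀ k n → lookupE (punchOutE k []) n ≡ []
  punchOut-[] zero    n       = refl
  punchOut-[] (suc k) zero    = refl
  punchOut-[] (suc k) (suc n) = punchOut-[] k n

  pad-[] : ∀ k n → lookupE (padE k []) n ≡ []
  pad-[] zero    n       = refl
  pad-[] (suc k) zero    = refl
  pad-[] (suc k) (suc n) = pad-[] k n

substEnv-+E : ∀ k Γ₁ Γ₂ {Δ Δ₁ Δ₂} → Δ ∼E Δ₁ +E Δ₂ →
  substEnv k (Γ₁ +E Γ₂) Δ ∼E substEnv k Γ₁ Δ₁ +E substEnv k Γ₂ Δ₂
substEnv-+E k Γ₁ Γ₂ {Δ} {Δ₁} {Δ₂} eΔ = begin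
  punchOutE k (Γ₁ +E Γ₂) +E padE k Δ
    ≈⟨ +E-cong (≡⇒∼E (punchOutE-+E k Γ₁ Γ₂)) (padE-cong k eΔ) ⟩
  (punchOutE k Γ₁ +E punchOutE k Γ₂) +E padE k (Δ₁ +E Δ₂)
    ≡⟨ cong (_ +E_) (padE-+E k Δ₁ Δ₂) ⟩
  (punchOutE k Γ₁ +E punchOutE k Γ₂) +E (padE k Δ₁ +E padE k Δ₂)
    ≈⟨ interchange (punchOutE k Γ₁) (punchOutE k Γ₂) (padE k Δ₁) (padE k Δ₂) ⟩
  substEnv k Γ₁ Δ₁ +E substEnv k Γ₂ Δ₂
    ∎
  where open SetoidReasoning ∼E-setoid

⊢-subst-var : ∀ k n {Γ ρ Δ u A} → ρ ∈ lookupE Γ n → Δ ⊢ᵐ u ∶ A → lookupE Γ k ≈ᵐ A →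
  substEnv k Γ Δ ⊢≈ substAt k u n ∶ ρ
⊢-subst-var zero zero {Γ} {Δ = Δ} i m e with ∈-≈ᵐ i e
... | ρ' , i' , s with ⊢ᵐ-∈ m i'
...   | Δ₁ , Δ₂ , eΔ , d = ≈-typed tailE-Δ s (⊢-weaken (tailE Γ +E Δ₂) d)
  where
  tailE-Δ : tailE Γ +E Δ ∼E (tailE Γ +E Δ₂) +E Δ₁
  tailE-Δ = ∼E-trans (+E-cong (∼E-refl {tailE Γ}) (∼E-trans eΔ (+E-comm Δ₁ Δ₂)))
                     (≡⇒∼E (≡.sym (+E-assoc (tailE Γ) Δ₂ Δ₁)))
⊢-subst-var zero (suc n) {Γ} {Δ = Δ} i m e =
  ⊢⇒⊢≈ (var (≡.subst (_ ∈_) (≡.sym (lookup-+E (tailE Γ) Δ n))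
              (∈-++⁺ˡ (≡.subst (_ ∈_) (≡.sym (tailE-lookup Γ n)) i))))
⊢-subst-var (suc k) zero {Γ} i m e =
  ⊢⇒⊢≈ (var (∈-++⁺ˡ (≡.subst (_ ∈_) (≡.sym (headE-lookup Γ)) i)))
⊢-subst-var (suc k) (suc n) {Γ} i m e
  with ⊢-subst-var k n {tailE Γ} (≡.subst (_ ∈_) (≡.sym (tailE-lookup Γ n)) i) m
         (≡.subst (_≈ᵐ _) (≡.sym (tailE-lookup Γ k)) e)
... | ≈-typed eΓ eρ d with ⊢-rename 0 d
...   | ≈-typed eΓ' eρ' d' =
  ≈-typed (∼E-trans (∷-congE ≈ᵐ-refl eΓ) (+E-cong (∼E-refl {headE Γ ∷ []}) eΓ'))
          (≈-trans eρ eρ') (⊢-weaken (headE Γ ∷ []) d')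

mutual
  ⊢-subst : ∀ k {Γ t τ Δ u A} → Γ ⊢ t ∶ τ → Δ ⊢ᵐ u ∶ A → lookupE Γ k ≈ᵐ A →
    substEnv k Γ Δ ⊢≈ subst (substAt k u) t ∶ τ
  ⊢-subst k (var {n = n} i) m e = ⊢-subst-var k n i m e
  ⊢-subst k (lam {Γ = Γ} d) m e =
    ⊢≈-resp ∼E-refl (arr (≈ᵐ-reflexive (≡.sym (++-identityʳ (headE Γ)))) ≈-refl)
      (⊢≈-lam (⊢-subst (suc k) d m (≡.subst (_≈ᵐ _) (tailE-lookup Γ k) e)))
  ⊢-subst k (app {Γ = Γ₁} {Δ = Γ₂} d dm eA A≢[]) m e
    with ⊢ᵐ-split (lookupE Γ₁ k) (lookupE Γ₂ k) m (≡.subst (_≈ᵐ _) (lookup-+E Γ₁ Γ₂ k) e)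
  ... | _ , _ , _ , _ , eΔ , e₁ , e₂ , m₁ , m₂ =
    ⊢≈-resp (substEnv-+E k Γ₁ Γ₂ eΔ) ≈-refl
      (⊢≈-app (⊢-subst k d m₁ e₁) (⊢ᵐ-subst k dm m₂ e₂) eA A≢[])
  ⊢-subst k (app[] {Γ = Γ₁} {Δ = Γ₂} d dm) m e
    with ⊢ᵐ-split (lookupE Γ₁ k) (lookupE Γ₂ k) m (≡.subst (_≈ᵐ _) (lookup-+E Γ₁ Γ₂ k) e)
  ... | _ , _ , _ , _ , eΔ , e₁ , e₂ , m₁ , m₂ =
    ⊢≈-resp (substEnv-+E k Γ₁ Γ₂ eΔ) ≈-refl
      (⊢≈-app[] (⊢-subst k d m₁ e₁) (⊢ᵐ-subst k dm m₂ e₂))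

  ⊢ᵐ-subst : ∀ k {Γ t B Δ u A} → Γ ⊢ᵐ t ∶ B → Δ ⊢ᵐ u ∶ A → lookupE Γ k ≈ᵐ A →
    substEnv k Γ Δ ⊢ᵐ≈ subst (substAt k u) t ∶ B
  ⊢ᵐ-subst k [] [] [] = ≈ᵐ-typed (substEnv-[] k) [] []
  ⊢ᵐ-subst k (_∷_ {Δ = Γ₁} {Δs = Γ₂} d dm) m e
    with ⊢ᵐ-split (lookupE Γ₁ k) (lookupE Γ₂ k) m (≡.subst (_≈ᵐ _) (lookup-+E Γ₁ Γ₂ k) e)
  ... | _ , _ , _ , _ , eΔ , e₁ , e₂ , m₁ , m₂ =
    ⊢ᵐ≈-resp (substEnv-+E k Γ₁ Γ₂ eΔ) (⊢ᵐ≈-∷ (⊢-subst k d m₁ e₁) (⊢ᵐ-subst k dm m₂ e₂))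

lam-inversion : ∀ {Γ t A τ} → Γ ⊢ lam t ∶ (A ⇒ τ) →
  Σ Env λ Γ₀ → (Γ ≡ tailE Γ₀) × (headE Γ₀ ≡ A) × (Γ₀ ⊢ t ∶ τ)
lam-inversion (lam d) = _ , refl , refl , d

mutual
  subject-reduction : ∀ {Γ t t' σ} → Γ ⊢ t ∶ σ → t →β t' → Γ ⊢≈ t' ∶ σ
  subject-reduction (app d m e A≢[]) β with lam-inversion d
  ... | Γ₀ , refl , refl , d₀ = ⊢-subst 0 d₀ m (≡.subst (_≈ᵐ _) (headE-lookup Γ₀) e)
  -- u is erased: its family of derivations substituted for x is empty, and
  -- the environment Δ of its discarded derivation is recovered by weakening.
  subject-reduction (app[] {Δ = Δ} {u = u} d m) β with lam-inversion d
  ... | Γ₀ , refl , x∉Γ₀ , d₀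
    with ⊢-subst 0 {u = u} d₀ [] (≈ᵐ-reflexive (≡.trans (≡.sym (headE-lookup Γ₀)) x∉Γ₀))
  ...   | ≈-typed {Γ'} eΓ eτ d' = ≈-typed env eτ (⊢-weaken Δ d')
    where
    env : tailE Γ₀ +E Δ ∼E Δ +E Γ'
    env = ∼E-trans (+E-comm (tailE Γ₀) Δ)
            (+E-cong (∼E-refl {Δ}) (∼E-trans (≡⇒∼E (≡.sym (+E-identityʳ (tailE Γ₀)))) eΓ))
  subject-reduction (lam d) (ξlam r) = ⊢≈-lam (subject-reduction d r)
  subject-reduction (app d m e A≢[]) (ξl r) = ⊢≈-app (subject-reduction d r) (⊢ᵐ⇒⊢ᵐ≈ m) e A≢[]
  subject-reduction (app[] d m) (ξl r) = ⊢≈-app[] (subject-reduction d r) (⊢ᵐ⇒⊢ᵐ≈ m)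
  subject-reduction (app d m e A≢[]) (ξr r) = ⊢≈-app (⊢⇒⊢≈ d) (subject-reductionᵐ m r) e A≢[]
  subject-reduction (app[] d m) (ξr r) = ⊢≈-app[] (⊢⇒⊢≈ d) (subject-reductionᵐ m r)

  subject-reductionᵐ : ∀ {Δ u u' A} → Δ ⊢ᵐ u ∶ A → u →β u' → Δ ⊢ᵐ≈ u' ∶ A
  subject-reductionᵐ []      r = ⊢ᵐ⇒⊢ᵐ≈ []
  subject-reductionᵐ (d ∷ m) r = ⊢ᵐ≈-∷ (subject-reduction d r) (subject-reductionᵐ m r)

proposition4p8 : ∀ {Γ t t' σ} → Γ ⊢ t ∶ σ → t →β t' →
    Σ Env (λ Γ' → Σ Ty (λ σ' → (Γ ≈E Γ') × (σ ≈ σ') × (Γ' ⊢ t' ∶ σ')))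
proposition4p8 d r with subject-reduction d r
... | ≈-typed eΓ eσ d' = _ , _ , ∼E⇒≈E eΓ , eσ , d'
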